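{- Let $g:E_G\to Q$ be a uniformly random colouring of the edges of an $n\times n$ puzzle grid with $|Q|=q$. Let $e_1,\dots,e_m$ be pairwise disjoint pairs $e_i=\{h_i^1,h_i^2\}$ of distinct half-edges such that, for each $i$, $h_i^1$ and $h_i^2$ are not partners. Assume that for every $i\in[m]$ at most one of the partners of $h_i^1$ and $h_i^2$ (where they exist) belongs to $\bigcup_{k=1}^{i-1} e_k$. Then $$\Pr[\text{all } e_1,\dots,e_m \text{ are monochromatic}]=\frac{1}{q^m}.$$
   Context: The grid $G$ consists of $n^2$ square pieces, each with four sides called half-edges. Two half-edges of pieces adjacent in $G$ that touch form an edge of $G$ and are called partners; a half-edge on the outer border of $G$ forms an edge by itself and has no partner. $E_G$ is the set of edges. The random colouring $g$ assigns each edge of $E_G$ an independent uniform colour from $Q$, and each half-edge gets the colour of the edge of $E_G$ containing it. A pair $e_i=\{h_i^1,h_i^2\}$ is monochromatic if $h_i^1$ and $h_i^2$ receive the same colour. (Such pairs arise as "new edges" of a rearrangement of the pieces: pairs of half-edges touching in the rearrangement that are not partners.) -}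

module Defs where

open import Data.Nat using (ℕ; zero; suc; _<_)
open import Data.Fin using (Fin; zero; suc; inject₁; toℕ; _≟_)
open import Data.Fin.Properties using (all?)
open import Data.Product using (_×_; _,_; proj₁; proj₂; Σ; ∃)
open import Data.Sum using (_⊎_; inj₁; inj₂; [_,_])
open import Data.List using (List; []; _∷_; map; concatMap; allFin; cartesianProductWith; filter; length)
open import Relation.Binary.PropositionalEquality using (_≡_; _≢_)
open import Relation.Nullary using (¬_; Dec)
open import Function using (_∘_)

data Side : Set where
  N E S W : Side

-- A piece of the n×n grid G is (row , column); a half-edge is a piece and a side.
Piece : ℕ → Set
Piece n = Fin n × Fin n

HalfEdge : ℕ → Set
HalfEdge n = Piece n × Side

-- The edges E_G of the grid: horizontal unit segments (horizontal grid line r ∈ {0..n},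
-- column c) and vertical unit segments (row r, vertical grid line c ∈ {0..n}).
Edge : ℕ → Set
Edge n = (Fin (suc n) × Fin n) ⊎ (Fin n × Fin (suc n))

-- The edge of E_G containing a half-edge (row 0 is the top row, column 0 the left one).
edgeOf : ∀ {n} → HalfEdge n → Edge n
edgeOf ((i , j) , N) = inj₁ (inject₁ i , j)
edgeOf ((i , j) , S) = inj₁ (suc i , j)
edgeOf ((i , j) , W) = inj₂ (i , inject₁ j)
edgeOf ((i , j) , E) = inj₂ (i , suc j)

Partner : ∀ {n} → HalfEdge n → HalfEdge n → Set
Partner h h' = h ≢ h' × edgeOf h ≡ edgeOf h'

Colouring : ℕ → ℕ → Set
Colouring n q = Edge n → Fin q

colourOf : ∀ {n q} → Colouring n q → HalfEdge n → Fin q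
colourOf g h = g (edgeOf h)

Monochromatic : ∀ {n q} → Colouring n q → HalfEdge n × HalfEdge n → Set
Monochromatic g (h₁ , h₂) = colourOf g h₁ ≡ colourOf g h₂

funsFin : ∀ {C : Set} → List C → (k : ℕ) → List (Fin k → C)
funsFin cs zero = (λ ()) ∷ []
funsFin {C} cs (suc k) = concatMap (λ c → map (ext c) (funsFin cs k)) cs
  where
  ext : C → (Fin k → C) → Fin (suc k) → C
  ext c f zero = c
  ext c f (suc i) = f i

funsProd : ∀ {C : Set} → List C → (a b : ℕ) → List (Fin a × Fin b → C)
funsProd cs a b = map (λ f p → f (proj₁ p) (proj₂ p)) (funsFin (funsFin cs b) a)

-- The list of all colourings E_G → Fin q (each exactly once): the sample space of
-- the uniformly random colouring g; it has q ^ |E_G| elements.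
allColourings : (n q : ℕ) → List (Colouring n q)
allColourings n q =
  cartesianProductWith (λ f g → [ f , g ])
    (funsProd (allFin q) (suc n) n) (funsProd (allFin q) n (suc n))

allMono? : ∀ {n q m} (es : Fin m → HalfEdge n × HalfEdge n) (g : Colouring n q) →
           Dec (∀ i → Monochromatic g (es i))
allMono? es g = all? (λ i → colourOf g (proj₁ (es i)) ≟ colourOf g (proj₂ (es i)))

countAllMono : ∀ {m} (n q : ℕ) (es : Fin m → HalfEdge n × HalfEdge n) → ℕ
countAllMono n q es = length (filter (allMono? es) (allColourings n q))

_∈ₚ_ : ∀ {n} → HalfEdge n → HalfEdge n × HalfEdge n → Set
h ∈ₚ e = h ≡ proj₁ e ⊎ h ≡ proj₂ e

InEarlier : ∀ {n m} → (Fin m → HalfEdge n × HalfEdge n) → Fin m → HalfEdge n → Set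
InEarlier es i h = Σ _ λ k → toℕ k < toℕ i × h ∈ₚ es k

-- Each pair e_i only constrains the colours of the two edges carrying its half-edges,
-- and these edges differ since the half-edges are not partners.  By disjointness, the
-- hypothesis on partners says that one of the two edges, v, carries no half-edge of an
-- earlier pair; call the other one u.  Recolouring v by the transposition of g u and a
-- colour c is then a bijection on colourings that preserves the conditions e_1 … e_{i-1}
-- and maps {g v = g u} onto {g v = c}.  Hence exactly one q-th of the colourings
-- satisfying e_1 … e_{i-1} also satisfies e_i, and induction on m gives the count.
module Submission where

open import Defs
open import Data.Bool.Base using (true; false; if_then_else_)
open import Data.Empty using (⊥-elim)
open import Data.Fin.Base using (Fin; zero; suc; toℕ; inject₁; fromℕ)
open import Data.Fin.Permutation.Components using (transpose; transpose-inverse)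
open import Data.Fin.Properties using (_≟_; all?; any?; toℕ-inject₁; toℕ-fromℕ; inject₁ℕ<)
open import Data.List.Base
  using (List; []; _∷_; map; _++_; concatMap; filter; length; allFin; cartesianProductWith)
open import Data.List.Properties using (map-++; map-cong; map-∘; map-tabulate; length-tabulate)
open import Data.Nat.Base using (ℕ; zero; suc; _+_; _*_; _^_; _<_)
open import Data.Nat.ListAction using (sum)
open import Data.Nat.ListAction.Properties using (sum-++)
open import Data.Nat.Properties
  using (+-commutativeSemigroup; *-assoc; *-comm; *-identityʳ; *-zeroʳ; +-identityʳ; *-distribˡ-+; <-irrefl; _<?_)
open import Algebra.Properties.CommutativeSemigroup +-commutativeSemigroup using (interchange)
open import Data.Product.Base using (_×_; _,_; proj₁; proj₂; ∃; curry; uncurry)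
open import Data.Product.Properties using () renaming (≡-dec to ×-≡-dec)
open import Data.Sum.Base using (_⊎_; inj₁; inj₂; [_,_]) renaming (map to ⊎-map)
open import Data.Sum.Properties using () renaming (≡-dec to ⊎-≡-dec)
open import Function.Base using (_∘_; id)
open import Function.Bundles using (_⇔_; mk⇔; Equivalence)
open import Data.Product.Function.NonDependent.Propositional using (_×-⇔_)
open import Level using (0ℓ)
open import Relation.Binary.Core using (Rel)
open import Relation.Binary.Definitions using (Decidable; DecidableEquality)
open import Relation.Binary.PropositionalEquality
  using (_≡_; _≢_; _≗_; refl; sym; trans; cong; cong₂; subst; subst₂; ≢-sym; module ≡-Reasoning)
open import Relation.Nullary using (¬_; Dec; does; yes; no)
open import Relation.Nullary.Decidable using (_×-dec_; _⊎-dec_; map′; does-⇔; dec-true; dec-false)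

private variable
  A B C : Set

𝟙 : Dec A → ℕ
𝟙 a = if does a then 1 else 0

𝟙-× : (a : Dec A) (b : Dec B) → 𝟙 (a ×-dec b) ≡ 𝟙 a * 𝟙 b
𝟙-× (yes _) b = sym (+-identityʳ (𝟙 b))
𝟙-× (no _)  b = refl

𝟙-cong : A ⇔ B → (a : Dec A) (b : Dec B) → 𝟙 a ≡ 𝟙 b
𝟙-cong A⇔B a b = cong (if_then 1 else 0) (does-⇔ A⇔B a b)

∑ : List A → (A → ℕ) → ℕ
∑ xs f = sum (map f xs)

infix 5 ∑
syntax ∑ xs (λ x → e) = ∑[ x ∈ xs ] e

∑-cong : ∀ (xs : List A) {f g : A → ℕ} → (∀ x → f x ≡ g x) → ∑ xs f ≡ ∑ xs g
∑-cong xs f≗g = cong sum (map-cong f≗g xs)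

∑-++ : ∀ (xs ys : List A) (f : A → ℕ) → ∑ (xs ++ ys) f ≡ ∑ xs f + ∑ ys f
∑-++ xs ys f = trans (cong sum (map-++ f xs ys)) (sum-++ (map f xs) (map f ys))

∑-map : ∀ (g : A → B) (xs : List A) (f : B → ℕ) → ∑ (map g xs) f ≡ ∑ xs (f ∘ g)
∑-map g xs f = cong sum (sym (map-∘ xs))

∑-const : ∀ (xs : List A) k → ∑[ x ∈ xs ] k ≡ length xs * k
∑-const []       k = refl
∑-const (x ∷ xs) k = cong (k +_) (∑-const xs k)

∑-*ˡ : ∀ (xs : List A) k (f : A → ℕ) → ∑[ x ∈ xs ] k * f x ≡ k * ∑ xs f
∑-*ˡ []       k f = sym (*-zeroʳ k)
∑-*ˡ (x ∷ xs) k f = trans (cong (k * f x +_) (∑-*ˡ xs k f)) (sym (*-distribˡ-+ k (f x) _))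

∑-+ : ∀ (xs : List A) (f g : A → ℕ) → ∑[ x ∈ xs ] (f x + g x) ≡ ∑ xs f + ∑ xs g
∑-+ []       f g = refl
∑-+ (x ∷ xs) f g = trans (cong (f x + g x +_) (∑-+ xs f g)) (interchange (f x) (g x) _ _)

∑-swap : ∀ (xs : List A) (ys : List B) (f : A → B → ℕ) →
         ∑[ x ∈ xs ] ∑[ y ∈ ys ] f x y ≡ ∑[ y ∈ ys ] ∑[ x ∈ xs ] f x y
∑-swap []       ys f = sym (trans (∑-const ys 0) (*-zeroʳ (length ys)))
∑-swap (x ∷ xs) ys f =
  trans (cong (∑ ys (f x) +_) (∑-swap xs ys f)) (sym (∑-+ ys (f x) (λ y → ∑[ x′ ∈ xs ] f x′ y)))

∑-concatMap : ∀ (g : A → List B) (xs : List A) (f : B → ℕ) →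
              ∑ (concatMap g xs) f ≡ ∑[ x ∈ xs ] ∑ (g x) f
∑-concatMap g []       f = refl
∑-concatMap g (x ∷ xs) f =
  trans (∑-++ (g x) (concatMap g xs) f) (cong (∑ (g x) f +_) (∑-concatMap g xs f))

∑-cartesianProductWith : ∀ (g : A → B → C) xs ys (f : C → ℕ) →
  ∑ (cartesianProductWith g xs ys) f ≡ ∑[ x ∈ xs ] ∑[ y ∈ ys ] f (g x y)
∑-cartesianProductWith g []       ys f = refl
∑-cartesianProductWith g (x ∷ xs) ys f =
  trans (∑-++ (map (g x) ys) _ f) (cong₂ _+_ (∑-map (g x) ys f) (∑-cartesianProductWith g xs ys f))

length-filter≡∑𝟙 : ∀ {P : A → Set} (P? : ∀ x → Dec (P x)) xs → length (filter P? xs) ≡ ∑[ x ∈ xs ] 𝟙 (P? x)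
length-filter≡∑𝟙 P? []       = refl
length-filter≡∑𝟙 P? (x ∷ xs) with does (P? x)
... | true  = cong suc (length-filter≡∑𝟙 P? xs)
... | false = length-filter≡∑𝟙 P? xs

-- Functions can only be compared pointwise, so enumerations are unique up to a decidable ≈.
ListsOnce : {_≈_ : Rel A 0ℓ} → Decidable _≈_ → List A → Set
ListsOnce _≈?_ xs = ∀ t → ∑[ x ∈ xs ] 𝟙 (x ≈? t) ≡ 1

∑∑-𝟙-× : ∀ {P : A → Set} {Q : B → Set} (P? : ∀ x → Dec (P x)) (Q? : ∀ y → Dec (Q y)) xs ys →
         ∑[ x ∈ xs ] 𝟙 (P? x) ≡ 1 → ∑[ y ∈ ys ] 𝟙 (Q? y) ≡ 1 →
         ∑[ x ∈ xs ] ∑[ y ∈ ys ] 𝟙 (P? x ×-dec Q? y) ≡ 1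
∑∑-𝟙-× P? Q? xs ys onceˣ onceʸ = begin
  ∑[ x ∈ xs ] ∑[ y ∈ ys ] 𝟙 (P? x ×-dec Q? y)
    ≡⟨ ∑-cong xs (λ x → ∑-cong ys (λ y → 𝟙-× (P? x) (Q? y))) ⟩
  ∑[ x ∈ xs ] ∑[ y ∈ ys ] 𝟙 (P? x) * 𝟙 (Q? y)
    ≡⟨ ∑-cong xs (λ x → ∑-*ˡ ys (𝟙 (P? x)) (𝟙 ∘ Q?)) ⟩
  ∑[ x ∈ xs ] 𝟙 (P? x) * (∑[ y ∈ ys ] 𝟙 (Q? y))
    ≡⟨ ∑-cong xs (λ x → cong (𝟙 (P? x) *_) onceʸ) ⟩
  ∑[ x ∈ xs ] 𝟙 (P? x) * 1
    ≡⟨ ∑-cong xs (λ x → *-identityʳ (𝟙 (P? x))) ⟩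
  ∑[ x ∈ xs ] 𝟙 (P? x)
    ≡⟨ onceˣ ⟩
  1
    ∎
  where open ≡-Reasoning

∑-allFin-suc : ∀ q (f : Fin (suc q) → ℕ) → ∑ (allFin (suc q)) f ≡ f zero + (∑[ c ∈ allFin q ] f (suc c))
∑-allFin-suc q f =
  cong (f zero +_) (trans (cong (λ cs → ∑ cs f) (sym (map-tabulate id suc))) (∑-map suc (allFin q) f))

allFin-once : ∀ q → ListsOnce _≟_ (allFin q)
allFin-once (suc q) zero    = begin
  ∑[ c ∈ allFin (suc q) ] 𝟙 (c ≟ zero)
    ≡⟨ ∑-allFin-suc q (λ c → 𝟙 (c ≟ zero)) ⟩
  1 + (∑[ c ∈ allFin q ] 0)
    ≡⟨ cong suc (∑-const (allFin q) 0) ⟩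
  1 + length (allFin q) * 0
    ≡⟨ cong suc (*-zeroʳ (length (allFin q))) ⟩
  1
    ∎
  where open ≡-Reasoning
allFin-once (suc q) (suc t) = trans (∑-allFin-suc q (λ c → 𝟙 (c ≟ suc t))) (allFin-once q t)

pointwise? : {_≈_ : Rel A 0ℓ} → Decidable _≈_ → ∀ {k} (f g : Fin k → A) → Dec (∀ i → f i ≈ g i)
pointwise? _≈?_ f g = all? (λ i → f i ≈? g i)

funsFin-once : {_≈_ : Rel A 0ℓ} (_≈?_ : Decidable _≈_) {cs : List A} →
               ListsOnce _≈?_ cs → ∀ k → ListsOnce (pointwise? _≈?_) (funsFin cs k)
funsFin-once _≈?_ once zero    t = refl
-- 𝟙 inspects only `does`, and `does (all? P?)` unfolds to `does (P? zero) ∧ does (all? (P? ∘ suc))`,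
-- so after reindexing each summand is already 𝟙 of a `×-dec`.
funsFin-once _≈?_ {cs} once (suc k) t =
  trans (∑-concatMap _ cs (λ f → 𝟙 (pointwise? _≈?_ f t)))
        (trans (∑-cong cs (λ c → ∑-map _ (funsFin cs k) (λ f → 𝟙 (pointwise? _≈?_ f t))))
               (∑∑-𝟙-× (_≈? t zero) (λ f → pointwise? _≈?_ f (t ∘ suc)) cs (funsFin cs k)
                       (once (t zero)) (funsFin-once _≈?_ once k (t ∘ suc))))

pointwise²? : {_≈_ : Rel A 0ℓ} → Decidable _≈_ → ∀ {a b} (f g : Fin a × Fin b → A) →
              Dec (∀ i j → f (i , j) ≈ g (i , j))
pointwise²? _≈?_ f g = pointwise? (pointwise? _≈?_) (curry f) (curry g)

funsProd-once : {_≈_ : Rel A 0ℓ} (_≈?_ : Decidable _≈_) {cs : List A} →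
                ListsOnce _≈?_ cs → ∀ a b → ListsOnce (pointwise²? _≈?_) (funsProd cs a b)
funsProd-once _≈?_ {cs} once a b t =
  trans (∑-map _ (funsFin (funsFin cs b) a) (λ f → 𝟙 (pointwise²? _≈?_ f t)))
        (funsFin-once (pointwise? _≈?_) (funsFin-once _≈?_ once b) a (curry t))

module _ {_≈_ : Rel A 0ℓ} (_≈?_ : Decidable _≈_) {xs : List A} (once : ListsOnce _≈?_ xs) where

  ∑-pick : (f : A → ℕ) → (∀ {x y} → x ≈ y → f x ≡ f y) → ∀ t → ∑[ x ∈ xs ] f x * 𝟙 (x ≈? t) ≡ f t
  ∑-pick f f-cong t = begin
    ∑[ x ∈ xs ] f x * 𝟙 (x ≈? t)
      ≡⟨ ∑-cong xs move ⟩
    ∑[ x ∈ xs ] f t * 𝟙 (x ≈? t)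
      ≡⟨ ∑-*ˡ xs (f t) (λ x → 𝟙 (x ≈? t)) ⟩
    f t * (∑[ x ∈ xs ] 𝟙 (x ≈? t))
      ≡⟨ cong (f t *_) (once t) ⟩
    f t * 1
      ≡⟨ *-identityʳ (f t) ⟩
    f t
      ∎
    where
    open ≡-Reasoning
    move : ∀ x → f x * 𝟙 (x ≈? t) ≡ f t * 𝟙 (x ≈? t)
    move x with x ≈? t
    ... | yes x≈t = cong (_* 1) (f-cong x≈t)
    ... | no  _   = trans (*-zeroʳ (f x)) (sym (*-zeroʳ (f t)))

  ∑-reindex : (φ ψ : A → A) → (∀ x y → y ≈ φ x ⇔ x ≈ ψ y) →
              (f : A → ℕ) → (∀ {x y} → x ≈ y → f x ≡ f y) → ∑[ x ∈ xs ] f (φ x) ≡ ∑ xs f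
  ∑-reindex φ ψ φ⇔ψ f f-cong = begin
    ∑[ x ∈ xs ] f (φ x)
      ≡⟨ ∑-cong xs (λ x → sym (∑-pick f f-cong (φ x))) ⟩
    ∑[ x ∈ xs ] ∑[ y ∈ xs ] f y * 𝟙 (y ≈? φ x)
      ≡⟨ ∑-swap xs xs (λ x y → f y * 𝟙 (y ≈? φ x)) ⟩
    ∑[ y ∈ xs ] ∑[ x ∈ xs ] f y * 𝟙 (y ≈? φ x)
      ≡⟨ ∑-cong xs (λ y → ∑-cong xs (λ x → cong (f y *_) (𝟙-cong (φ⇔ψ x y) (y ≈? φ x) (x ≈? ψ y)))) ⟩
    ∑[ y ∈ xs ] ∑[ x ∈ xs ] f y * 𝟙 (x ≈? ψ y)
      ≡⟨ ∑-cong xs (λ y → ∑-pick (λ _ → f y) (λ _ → refl) (ψ y)) ⟩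
    ∑[ y ∈ xs ] f y
      ∎
    where open ≡-Reasoning

∑-fibres : ∀ {q} (κ : A → Fin q) (xs : List A) (f : A → ℕ) →
           ∑ xs f ≡ ∑[ c ∈ allFin q ] ∑[ x ∈ xs ] f x * 𝟙 (c ≟ κ x)
∑-fibres {q = q} κ xs f = begin
  ∑[ x ∈ xs ] f x
    ≡⟨ ∑-cong xs (λ x → sym (*-identityʳ (f x))) ⟩
  ∑[ x ∈ xs ] f x * 1
    ≡⟨ ∑-cong xs (λ x → cong (f x *_) (sym (allFin-once q (κ x)))) ⟩
  ∑[ x ∈ xs ] f x * (∑[ c ∈ allFin q ] 𝟙 (c ≟ κ x))
    ≡⟨ ∑-cong xs (λ x → sym (∑-*ˡ (allFin q) (f x) (λ c → 𝟙 (c ≟ κ x)))) ⟩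
  ∑[ x ∈ xs ] ∑[ c ∈ allFin q ] f x * 𝟙 (c ≟ κ x)
    ≡⟨ ∑-swap xs (allFin q) (λ x c → f x * 𝟙 (c ≟ κ x)) ⟩
  ∑[ c ∈ allFin q ] ∑[ x ∈ xs ] f x * 𝟙 (c ≟ κ x)
    ∎
  where open ≡-Reasoning

transpose-≡ʳ : ∀ {q} (i j k : Fin q) → transpose i j k ≡ j ⇔ k ≡ i
transpose-≡ʳ i j k = mk⇔ to from
  where
  transpose-at : ∀ {q} (i j : Fin q) → transpose i j i ≡ j
  transpose-at i j rewrite dec-true (i ≟ i) refl = refl
  to : transpose i j k ≡ j → k ≡ i
  to t≡j = begin
    k
      ≡⟨ sym (transpose-inverse j i) ⟩
    transpose j i (transpose i j k)
      ≡⟨ cong (transpose j i) t≡j ⟩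
    transpose j i j
      ≡⟨ transpose-at j i ⟩
    i
      ∎
    where open ≡-Reasoning
  from : k ≡ i → transpose i j k ≡ j
  from refl = transpose-at i j

∀-snoc : ∀ {m} {P : Fin (suc m) → Set} → (∀ j → P (inject₁ j)) → P (fromℕ m) → ∀ i → P i
∀-snoc {zero}          init last zero    = last
∀-snoc {suc m}         init last zero    = init zero
∀-snoc {suc m} {P = P} init last (suc i) = ∀-snoc {P = P ∘ suc} (init ∘ suc) last i

_∈²_ : A → A × A → Set
x ∈² p = x ≡ proj₁ p ⊎ x ≡ proj₂ p

module _ {n : ℕ} where

  _≟ₑ_ : DecidableEquality (Edge n)
  _≟ₑ_ = ⊎-≡-dec (×-≡-dec _≟_ _≟_) (×-≡-dec _≟_ _≟_)

  OccursBefore : ∀ {m} → (Fin m → Edge n × Edge n) → Fin m → Edge n → Set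
  OccursBefore ps i v = ∃ λ k → toℕ k < toℕ i × v ∈² ps k

  occursBefore-inject₁ : ∀ {m} (ps : Fin (suc m) → Edge n × Edge n) {i v} →
                         OccursBefore (ps ∘ inject₁) i v → OccursBefore ps (inject₁ i) v
  occursBefore-inject₁ ps {i} (k , k<i , v∈) =
    inject₁ k , subst₂ _<_ (sym (toℕ-inject₁ k)) (sym (toℕ-inject₁ i)) k<i , v∈

  fresh-at-last : ∀ {m} (ps : Fin (suc m) → Edge n × Edge n) {v} →
                ¬ OccursBefore ps (fromℕ m) v → ∀ j → ¬ v ∈² ps (inject₁ j)
  fresh-at-last {m} ps v-fresh j v∈ =
    v-fresh (inject₁ j , subst (toℕ (inject₁ j) <_) (sym (toℕ-fromℕ m)) (inject₁ℕ< j) , v∈)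

  occursBefore? : ∀ {m} (ps : Fin m → Edge n × Edge n) i v → Dec (OccursBefore ps i v)
  occursBefore? ps i v =
    any? (λ k → (toℕ k <? toℕ i) ×-dec ((v ≟ₑ proj₁ (ps k)) ⊎-dec (v ≟ₑ proj₂ (ps k))))

  HasFreshEdge : ∀ {m} → (Fin m → Edge n × Edge n) → Fin m → Set
  HasFreshEdge ps i = ¬ OccursBefore ps i (proj₁ (ps i)) ⊎ ¬ OccursBefore ps i (proj₂ (ps i))

module _ {n q : ℕ} where

  _≗?_ : (g h : Colouring n q) → Dec (g ≗ h)
  g ≗? h = map′ (λ (g≗ₕh , g≗ᵥh) → [ uncurry g≗ₕh , uncurry g≗ᵥh ])
                (λ g≗h → curry (g≗h ∘ inj₁) , curry (g≗h ∘ inj₂))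
                (pointwise²? _≟_ (g ∘ inj₁) (h ∘ inj₁) ×-dec pointwise²? _≟_ (g ∘ inj₂) (h ∘ inj₂))

  allColourings-once : ListsOnce _≗?_ (allColourings n q)
  allColourings-once t =
    trans (∑-cartesianProductWith _ (funsProd (allFin q) (suc n) n) (funsProd (allFin q) n (suc n))
                                  (λ g → 𝟙 (g ≗? t)))
          (∑∑-𝟙-× (λ f → pointwise²? _≟_ f (t ∘ inj₁)) (λ f → pointwise²? _≟_ f (t ∘ inj₂))
                  (funsProd (allFin q) (suc n) n) (funsProd (allFin q) n (suc n))
                  (funsProd-once _≟_ {allFin q} (allFin-once q) (suc n) n (t ∘ inj₁))
                  (funsProd-once _≟_ {allFin q} (allFin-once q) n (suc n) (t ∘ inj₂)))

  recolour : Colouring n q → Edge n → Fin q → Colouring n q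
  recolour g v c e = if does (e ≟ₑ v) then c else g e

  recolour-at : ∀ g v c → recolour g v c v ≡ c
  recolour-at g v c rewrite dec-true (v ≟ₑ v) refl = refl

  recolour-off : ∀ g {v} c {e} → e ≢ v → recolour g v c e ≡ g e
  recolour-off g {v} c {e} e≢v rewrite dec-false (e ≟ₑ v) e≢v = refl

  IndependentOf : Edge n → (Colouring n q → Set) → Set
  IndependentOf v P = ∀ {g h} → (∀ {e} → e ≢ v → g e ≡ h e) → P g → P h

  module _ {u v : Edge n} (u≢v : u ≢ v) where

    recolourBy : (Fin q → Fin q → Fin q) → Colouring n q → Colouring n q
    recolourBy σ g = recolour g v (σ (g u) (g v))

    recolourBy-inverse : ∀ σ τ → (∀ a z → τ a (σ a z) ≡ z) →
                         ∀ {g h} → h ≗ recolourBy σ g → g ≗ recolourBy τ h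
    recolourBy-inverse σ τ τσ {g} {h} h≗σg e with e ≟ₑ v
    ... | yes refl = sym (trans (cong₂ τ hu≡gu hv≡σg) (τσ (g u) (g e)))
      where
      hu≡gu : h u ≡ g u
      hu≡gu = trans (h≗σg u) (recolour-off g _ u≢v)
      hv≡σg : h e ≡ σ (g u) (g e)
      hv≡σg = trans (h≗σg e) (recolour-at g e _)
    ... | no e≢v = sym (trans (h≗σg e) (recolour-off g _ e≢v))

    module _ {P : Colouring n q → Set} (P? : ∀ g → Dec (P g)) (P-indep : IndependentOf v P) where

      private
        count : (Colouring n q → ℕ) → ℕ
        count = ∑ (allColourings n q)

      fibre-size : ∀ c → count (λ g → 𝟙 (P? g ×-dec (c ≟ g v))) ≡
                         count (λ g → 𝟙 (P? g ×-dec (g v ≟ g u)))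
      fibre-size c = begin
        count (λ g → 𝟙 (P? g ×-dec (c ≟ g v)))
          ≡⟨ sym (∑-reindex _≗?_ {allColourings n q} allColourings-once φ ψ φ⇔ψ _ fibre-cong) ⟩
        count (λ g → 𝟙 (P? (φ g) ×-dec (c ≟ φ g v)))
          ≡⟨ ∑-cong (allColourings n q) (λ g →
               𝟙-cong (fibre⇔ g) (P? (φ g) ×-dec (c ≟ φ g v)) (P? g ×-dec (g v ≟ g u))) ⟩
        count (λ g → 𝟙 (P? g ×-dec (g v ≟ g u)))
          ∎
        where
        open ≡-Reasoning
        φ ψ : Colouring n q → Colouring n q
        φ = recolourBy (λ a → transpose a c)
        ψ = recolourBy (transpose c)
        φ⇔ψ : ∀ g h → h ≗ φ g ⇔ g ≗ ψ h
        φ⇔ψ g h =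
          mk⇔ (recolourBy-inverse (λ a → transpose a c) (transpose c) (λ a z → transpose-inverse c a))
              (recolourBy-inverse (transpose c) (λ a → transpose a c) (λ a z → transpose-inverse a c))
        fibre-cong : ∀ {g h} → g ≗ h → 𝟙 (P? g ×-dec (c ≟ g v)) ≡ 𝟙 (P? h ×-dec (c ≟ h v))
        fibre-cong {g} {h} g≗h = 𝟙-cong
          (mk⇔ (λ (p , c≡gv) → P-indep (λ _ → g≗h _) p , trans c≡gv (g≗h v))
               (λ (p , c≡hv) → P-indep (λ _ → sym (g≗h _)) p , trans c≡hv (sym (g≗h v))))
          (P? g ×-dec (c ≟ g v)) (P? h ×-dec (c ≟ h v))
        fibre⇔ : ∀ g → (P (φ g) × c ≡ φ g v) ⇔ (P g × g v ≡ g u)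
        fibre⇔ g =
          mk⇔ (P-indep (recolour-off g _)) (P-indep (λ e≢v → sym (recolour-off g _ e≢v)))
          ×-⇔
          mk⇔ (λ c≡φgv → to (sym (trans c≡φgv (recolour-at g v _))))
              (λ gv≡gu → sym (trans (recolour-at g v _) (from gv≡gu)))
          where open Equivalence (transpose-≡ʳ (g u) c (g v))

      count-fresh-equality : count (λ g → 𝟙 (P? g ×-dec (g v ≟ g u))) * q ≡ count (𝟙 ∘ P?)
      count-fresh-equality = sym (begin
        count (𝟙 ∘ P?)
          ≡⟨ ∑-fibres (λ g → g v) (allColourings n q) (𝟙 ∘ P?) ⟩
        ∑[ c ∈ allFin q ] count (λ g → 𝟙 (P? g) * 𝟙 (c ≟ g v))
          ≡⟨ ∑-cong (allFin q) (λ c → ∑-cong (allColourings n q) (λ g → sym (𝟙-× (P? g) (c ≟ g v)))) ⟩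
        ∑[ c ∈ allFin q ] count (λ g → 𝟙 (P? g ×-dec (c ≟ g v)))
          ≡⟨ ∑-cong (allFin q) fibre-size ⟩
        ∑[ c ∈ allFin q ] K
          ≡⟨ ∑-const (allFin q) K ⟩
        length (allFin q) * K
          ≡⟨ cong (_* K) (length-tabulate {n = q} id) ⟩
        q * K
          ≡⟨ *-comm q K ⟩
        K * q
          ∎)
        where
        open ≡-Reasoning
        K = count (λ g → 𝟙 (P? g ×-dec (g v ≟ g u)))

  AllEqual : ∀ {m} → (Fin m → Edge n × Edge n) → Colouring n q → Set
  AllEqual ps g = ∀ i → g (proj₁ (ps i)) ≡ g (proj₂ (ps i))

  allEqual? : ∀ {m} (ps : Fin m → Edge n × Edge n) g → Dec (AllEqual ps g)
  allEqual? ps g = all? (λ i → g (proj₁ (ps i)) ≟ g (proj₂ (ps i)))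

  ∑-allEqual-snoc : ∀ {m} (ps : Fin (suc m) → Edge n × Edge n) {u v} → u ≢ v →
    (∀ j → ¬ v ∈² ps (inject₁ j)) →
    (∀ g → (g (proj₁ (ps (fromℕ m))) ≡ g (proj₂ (ps (fromℕ m)))) ⇔ (g v ≡ g u)) →
    (∑[ g ∈ allColourings n q ] 𝟙 (allEqual? ps g)) * q ≡
    ∑[ g ∈ allColourings n q ] 𝟙 (allEqual? (ps ∘ inject₁) g)
  ∑-allEqual-snoc {m} ps {u} {v} u≢v v-fresh last⇔ =
    trans (cong (_* q) (∑-cong (allColourings n q) (λ g →
             𝟙-cong (split g) (allEqual? ps g) (allEqual? (ps ∘ inject₁) g ×-dec (g v ≟ g u)))))
          (count-fresh-equality u≢v (allEqual? (ps ∘ inject₁)) independent)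
    where
    split : ∀ g → AllEqual ps g ⇔ (AllEqual (ps ∘ inject₁) g × g v ≡ g u)
    split g = mk⇔ (λ eqs → eqs ∘ inject₁ , Equivalence.to (last⇔ g) (eqs (fromℕ m)))
                  (λ (init , gv≡gu) → ∀-snoc init (Equivalence.from (last⇔ g) gv≡gu))
    independent : IndependentOf v (AllEqual (ps ∘ inject₁))
    independent g≡h eqs j =
      trans (sym (g≡h (≢-sym (v-fresh j ∘ inj₁)))) (trans (eqs j) (g≡h (≢-sym (v-fresh j ∘ inj₂))))

  count-allEqual : ∀ m (ps : Fin m → Edge n × Edge n) →
    (∀ i → proj₁ (ps i) ≢ proj₂ (ps i)) →
    (∀ i → HasFreshEdge ps i) →
    (∑[ g ∈ allColourings n q ] 𝟙 (allEqual? ps g)) * q ^ m ≡ length (allColourings n q)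
  count-allEqual zero    ps distinct fresh =
    trans (*-identityʳ _) (trans (∑-const (allColourings n q) 1) (*-identityʳ _))
  count-allEqual (suc m) ps distinct fresh = begin
    count ps * (q * q ^ m)
      ≡⟨ sym (*-assoc (count ps) q (q ^ m)) ⟩
    count ps * q * q ^ m
      ≡⟨ cong (_* q ^ m) (last-pair (fresh (fromℕ m))) ⟩
    count (ps ∘ inject₁) * q ^ m
      ≡⟨ count-allEqual m (ps ∘ inject₁) (distinct ∘ inject₁) init-fresh ⟩
    length (allColourings n q)
      ∎
    where
    open ≡-Reasoning
    count : ∀ {k} → (Fin k → Edge n × Edge n) → ℕ
    count rs = ∑[ g ∈ allColourings n q ] 𝟙 (allEqual? rs g)
    last-pair : HasFreshEdge ps (fromℕ m) → count ps * q ≡ count (ps ∘ inject₁)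
    last-pair (inj₁ first-fresh) =
      ∑-allEqual-snoc ps (≢-sym (distinct (fromℕ m))) (fresh-at-last ps first-fresh) (λ g → mk⇔ id id)
    last-pair (inj₂ second-fresh) =
      ∑-allEqual-snoc ps (distinct (fromℕ m)) (fresh-at-last ps second-fresh) (λ g → mk⇔ sym sym)
    init-fresh : ∀ i → HasFreshEdge (ps ∘ inject₁) i
    init-fresh i = ⊎-map (_∘ occursBefore-inject₁ ps) (_∘ occursBefore-inject₁ ps) (fresh (inject₁ i))

ends : ∀ {n m} → (Fin m → HalfEdge n × HalfEdge n) → Fin m → Edge n × Edge n
ends es i = edgeOf (proj₁ (es i)) , edgeOf (proj₂ (es i))

half-edge-on : ∀ {n v} {e : HalfEdge n × HalfEdge n} → v ∈² (edgeOf (proj₁ e) , edgeOf (proj₂ e)) →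
               ∃ λ p → p ∈ₚ e × v ≡ edgeOf p
half-edge-on (inj₁ eq) = _ , inj₁ refl , eq
half-edge-on (inj₂ eq) = _ , inj₂ refl , eq

module _ {n m : ℕ} (es : Fin m → HalfEdge n × HalfEdge n)
         (disjoint : ∀ i j → i ≢ j → ∀ h → h ∈ₚ es i → ¬ (h ∈ₚ es j)) where

  earlier-half-edges-differ : ∀ {i k s p} → toℕ k < toℕ i → s ∈ₚ es i → p ∈ₚ es k → s ≢ p
  earlier-half-edges-differ k<i s∈eᵢ p∈eₖ refl =
    disjoint _ _ (λ { refl → <-irrefl refl k<i }) _ s∈eᵢ p∈eₖ

  partner-before : ∀ {i s} → s ∈ₚ es i → OccursBefore (ends es) i (edgeOf s) →
                   ∃ λ p → Partner s p × InEarlier es i p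
  partner-before s∈eᵢ (k , k<i , on-eₖ) with half-edge-on on-eₖ
  ... | p , p∈eₖ , eq = p , (earlier-half-edges-differ k<i s∈eᵢ p∈eₖ , eq) , k , k<i , p∈eₖ

  fresh-edge : (∀ i → ¬ (∃ λ p₁ → ∃ λ p₂ → Partner (proj₁ (es i)) p₁ × Partner (proj₂ (es i)) p₂ ×
                        InEarlier es i p₁ × InEarlier es i p₂)) →
               ∀ i → HasFreshEdge (ends es) i
  fresh-edge no-two-earlier i
    with occursBefore? (ends es) i (proj₁ (ends es i)) | occursBefore? (ends es) i (proj₂ (ends es i))
  ... | no first-fresh | _               = inj₁ first-fresh
  ... | yes _          | no second-fresh = inj₂ second-fresh
  ... | yes first-old | yes second-old
    with partner-before (inj₁ refl) first-old | partner-before (inj₂ refl) second-old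
  ... | p₁ , partner₁ , earlier₁ | p₂ , partner₂ , earlier₂ =
    ⊥-elim (no-two-earlier i (p₁ , p₂ , partner₁ , partner₂ , earlier₁ , earlier₂))

proposition1 : (n q m : ℕ) (es : Fin m → HalfEdge n × HalfEdge n) →
    (∀ i → proj₁ (es i) ≢ proj₂ (es i)) →
    (∀ i j → i ≢ j → ∀ h → h ∈ₚ es i → ¬ (h ∈ₚ es j)) →
    (∀ i → ¬ Partner (proj₁ (es i)) (proj₂ (es i))) →
    (∀ i → ¬ (∃ λ p₁ → ∃ λ p₂ → Partner (proj₁ (es i)) p₁ × Partner (proj₂ (es i)) p₂ ×
                 InEarlier es i p₁ × InEarlier es i p₂)) →
    countAllMono n q es * q ^ m ≡ length (allColourings n q)
proposition1 n q m es distinct disjoint not-partners no-two-earlier = begin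
  countAllMono n q es * q ^ m
    ≡⟨ cong (_* q ^ m) (length-filter≡∑𝟙 (allMono? es) (allColourings n q)) ⟩
  (∑[ g ∈ allColourings n q ] 𝟙 (allMono? es g)) * q ^ m
    -- allMono? es is literally allEqual? (ends es)
    ≡⟨ count-allEqual m (ends es) ends-distinct (fresh-edge es disjoint no-two-earlier) ⟩
  length (allColourings n q)
    ∎
  where
  open ≡-Reasoning
  ends-distinct : ∀ i → edgeOf (proj₁ (es i)) ≢ edgeOf (proj₂ (es i))
  ends-distinct i same-edge = not-partners i (distinct i , same-edge)
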